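{- Let $\mathcal{X}$ be a family of nonempty subsets of $[d]$. Let $(f_n)_{n\ge1}$ and $(g_n)_{n\geq1}$ be two sequences of functions $2^{[d]}\to\mathbb{Z}$, both starting with $f_1=g_1=\mathrm{val}_{\mathcal{X}}$ and each obtained by applying the update rule below (with arbitrary choices of the subsets at each step), and suppose both sequences are eventually constant, with eventual values $v$ and $v'$. Then $v=v'$.
   Context: A proper $\mathcal{X}$-sequence is a (possibly empty) sequence $\mathcal{S}=(X_1,\dots,X_k)$ of sets in $\mathcal{X}$ with $X_i\not\subseteq\bigcup_{j<i}X_j$ for $i=2,\dots,k$. For $F\subseteq[d]$, $\mathrm{val}(F,\mathcal{S})=|F\cup\bigcup_{i=1}^kX_i|-k$ and $\mathrm{val}_{\mathcal{X}}(F)=\min\{\mathrm{val}(F,\mathcal{S}):\mathcal{S}\text{ proper }\mathcal{X}\text{ -sequence}\}$. Update rule producing $h_{n+1}$ from $h_n$: (i) if there exist $A,B\subseteq[d]$ and $x\in\mathcal{X}$ with $A\cap B\subseteq x$ and $h_n(A\cup B)>h_n(A)+h_n(B)-\min\{|A\cap B|,|x|-1\}$, choose such $A,B,x$ and set $h_{n+1}(A\cup B)=h_n(A)+h_n(B)-\min\{|A\cap B|,|x|-1\}$, $h_{n+1}=h_n$ elsewhere; (ii) otherwise, if there exist $A\subsetneq B\subseteq[d]$ with $h_n(A)>h_n(B)$, choose such and set $h_{n+1}(A)=h_n(B)$, $h_{n+1}=h_n$ elsewhere; (iii) otherwise, if there exist $B\subsetneq A\subseteq[d]$ with $h_n(A)>h_n(B)+|A\setminus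 B|$, choose such and set $h_{n+1}(A)=h_n(B)+|A\setminus B|$, $h_{n+1}=h_n$ elsewhere; (iv) otherwise $h_{n+1}=h_n$. The eventual value of such a sequence is denoted $v_{\mathcal{X}}$. -}

module Defs where

open import Data.Nat as ℕ using (ℕ; suc)
open import Data.Integer as ℤ using (ℤ; +_; _+_; _-_; _<_; _≤_)
open import Data.Integer using () renaming (_⊓_ to min)
open import Data.Fin.Subset using (Subset; _∪_; _∩_; _─_; _⊆_; _⊈_; _⊂_; ⋃; ∣_∣; Nonempty; ⊥)
open import Data.List using (List; []; _∷_; length)
open import Data.List.Membership.Propositional using (_∈_)
open import Data.Product using (Σ; ∃; _×_; ∃-syntax)
open import Data.Unit using (⊤)
open import Relation.Binary.PropositionalEquality using (_≡_; _≢_)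
open import Relation.Nullary using (¬_)

Family : ℕ → Set
Family d = List (Subset d)

SetFun : ℕ → Set
SetFun d = Subset d → ℤ

module _ {d : ℕ} (𝒳 : Family d) where

  -- Proper 𝒳-sequences, given as a list (X₁ , … , X_k) in order.
  -- ProperFrom U S : every element lies in 𝒳 and is not contained in U ∪ (union of earlier ones).
  ProperFrom : Subset d → List (Subset d) → Set
  ProperFrom U []       = ⊤
  ProperFrom U (x ∷ xs) = (x ∈ 𝒳) × (x ⊈ U) × ProperFrom (U ∪ x) xs

  Proper : List (Subset d) → Set
  Proper []       = ⊤
  Proper (x ∷ xs) = (x ∈ 𝒳) × ProperFrom x xs

  valSeq : Subset d → List (Subset d) → ℤ
  valSeq F S = + ∣ F ∪ ⋃ S ∣ - + length S

  IsValX : Subset d → ℤ → Set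
  IsValX F v = (∃[ S ] (Proper S × valSeq F S ≡ v))
             × (∀ S → Proper S → v ℤ.≤ valSeq F S)

  UpdatedAt : SetFun d → Subset d → ℤ → SetFun d → Set
  UpdatedAt h C c h' = (h' C ≡ c) × (∀ D → D ≢ C → h' D ≡ h D)

  bound : Subset d → Subset d → Subset d → ℤ
  bound A B x = min (+ ∣ A ∩ B ∣) (+ ∣ x ∣ - + 1)

  CondI : SetFun d → Set
  CondI h = ∃[ A ] ∃[ B ] ∃[ x ] (x ∈ 𝒳 × (A ∩ B) ⊆ x
            × h A + h B - bound A B x < h (A ∪ B))

  CondII : SetFun d → Set
  CondII h = ∃[ A ] ∃[ B ] (A ⊂ B × h B < h A)

  CondIII : SetFun d → Set
  CondIII h = ∃[ A ] ∃[ B ] (B ⊂ A × h B + + ∣ A ─ B ∣ < h A)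

  data Step (h : SetFun d) (h' : SetFun d) : Set where
    ruleI   : ∀ A B x → x ∈ 𝒳 → (A ∩ B) ⊆ x
            → h A + h B - bound A B x < h (A ∪ B)
            → UpdatedAt h (A ∪ B) (h A + h B - bound A B x) h'
            → Step h h'
    ruleII  : ¬ CondI h
            → ∀ A B → A ⊂ B → h B < h A
            → UpdatedAt h A (h B) h'
            → Step h h'
    ruleIII : ¬ CondI h → ¬ CondII h
            → ∀ A B → B ⊂ A → h B + + ∣ A ─ B ∣ < h A
            → UpdatedAt h A (h B + + ∣ A ─ B ∣) h'
            → Step h h'
    ruleIV  : ¬ CondI h → ¬ CondII h → ¬ CondIII h
            → (∀ F → h' F ≡ h F)
            → Step h h'

  -- A sequence (f n)_{n ≥ 0} (f 0 plays the role of f₁) produced by the update rule from val_𝒳.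
  IsUpdateSeq : (ℕ → SetFun d) → Set
  IsUpdateSeq f = (∀ F → IsValX F (f 0 F)) × (∀ n → Step (f n) (f (suc n)))

  -- the sequence is constant from index N on (so its eventual value is f N)
  ConstantFrom : (ℕ → SetFun d) → ℕ → Set
  ConstantFrom f N = ∀ n → N ℕ.≤ n → ∀ F → f n F ≡ f N F

{-# OPTIONS --safe #-}
module Submission where

-- Every step of the update rule lowers h pointwise, and a set function h* to
-- which no rule applies stays pointwise below h through any step: the updated
-- value is bounded below by the same expression evaluated at h*, which in turn
-- dominates h* at the updated set because no rule applies to h*. An eventual
-- value is such a function (the step out of it must be rule (iv)) and lies below
-- val_𝒳, the common start of both sequences. Hence each eventual value lies
-- below the other, and they coincide.

open import Defs
open import Data.Nat using (ℕ; zero; suc)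
import Data.Nat.Properties as ℕ
open import Data.Integer using (-_; _≤_; _<_)
import Data.Integer.Properties as ℤ
open import Data.Fin.Subset using (Subset; Nonempty)
open import Data.List.Relation.Unary.All using (All)
open import Data.Bool.Properties using () renaming (_≟_ to _≟ᵇ_)
open import Data.Vec.Properties using (≡-dec)
open import Data.Product using (_,_; _×_)
open import Data.Empty using (⊥-elim)
open import Relation.Nullary using (¬_; Dec; yes; no)
open import Relation.Binary.PropositionalEquality using (_≡_; refl; sym; trans; subst)

_≤ᶠ_ : {d : ℕ} → SetFun d → SetFun d → Set
h ≤ᶠ h′ = ∀ F → h F ≤ h′ F

≤ᶠ-refl : {d : ℕ} {h : SetFun d} → h ≤ᶠ h
≤ᶠ-refl F = ℤ.≤-refl

≤ᶠ-trans : {d : ℕ} {h₁ h₂ h₃ : SetFun d} → h₁ ≤ᶠ h₂ → h₂ ≤ᶠ h₃ → h₁ ≤ᶠ h₃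
≤ᶠ-trans le₁₂ le₂₃ F = ℤ.≤-trans (le₁₂ F) (le₂₃ F)

_≟ˢ_ : {d : ℕ} (A B : Subset d) → Dec (A ≡ B)
_≟ˢ_ = ≡-dec _≟ᵇ_

module _ {d : ℕ} (𝒳 : Family d) where

  Stable : SetFun d → Set
  Stable h = ¬ CondI 𝒳 h × ¬ CondII 𝒳 h × ¬ CondIII 𝒳 h

  updatedAt-≤ᶠ : ∀ {h C c h′} → UpdatedAt 𝒳 h C c h′ → c ≤ h C → h′ ≤ᶠ h
  updatedAt-≤ᶠ {C = C} (h′C≡c , unchanged) c≤hC F with F ≟ˢ C
  ... | yes refl = subst (_≤ _) (sym h′C≡c) c≤hC
  ... | no F≢C   = ℤ.≤-reflexive (unchanged F F≢C)

  updatedAt-preserves-≤ᶠ : ∀ {h C c h′ v} → UpdatedAt 𝒳 h C c h′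
                         → v ≤ᶠ h → v C ≤ c → v ≤ᶠ h′
  updatedAt-preserves-≤ᶠ {C = C} {v = v} (h′C≡c , unchanged) v≤h vC≤c F with F ≟ˢ C
  ... | yes refl = subst (v F ≤_) (sym h′C≡c) vC≤c
  ... | no F≢C   = subst (v F ≤_) (sym (unchanged F F≢C)) (v≤h F)

  updatedAt-changes : ∀ {h C c h′} → UpdatedAt 𝒳 h C c h′ → c < h C → ¬ (∀ F → h′ F ≡ h F)
  updatedAt-changes (h′C≡c , _) c<hC h′≡h = ℤ.<-irrefl (trans (sym h′C≡c) (h′≡h _)) c<hC

  Step-≤ᶠ : ∀ {h h′} → Step 𝒳 h h′ → h′ ≤ᶠ h
  Step-≤ᶠ (ruleI _ _ _ _ _ lt upd)    = updatedAt-≤ᶠ upd (ℤ.<⇒≤ lt)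
  Step-≤ᶠ (ruleII _ _ _ _ lt upd)     = updatedAt-≤ᶠ upd (ℤ.<⇒≤ lt)
  Step-≤ᶠ (ruleIII _ _ _ _ _ lt upd)  = updatedAt-≤ᶠ upd (ℤ.<⇒≤ lt)
  Step-≤ᶠ (ruleIV _ _ _ h′≡h) F       = ℤ.≤-reflexive (h′≡h F)

  Step-unchanged⇒Stable : ∀ {h h′} → Step 𝒳 h h′ → (∀ F → h′ F ≡ h F) → Stable h
  Step-unchanged⇒Stable (ruleI _ _ _ _ _ lt upd)   h′≡h = ⊥-elim (updatedAt-changes upd lt h′≡h)
  Step-unchanged⇒Stable (ruleII _ _ _ _ lt upd)    h′≡h = ⊥-elim (updatedAt-changes upd lt h′≡h)
  Step-unchanged⇒Stable (ruleIII _ _ _ _ _ lt upd) h′≡h = ⊥-elim (updatedAt-changes upd lt h′≡h)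
  Step-unchanged⇒Stable (ruleIV ¬I ¬II ¬III _)     _    = ¬I , ¬II , ¬III

  Step-preserves-Stable-≤ᶠ : ∀ {v h h′} → Stable v → v ≤ᶠ h → Step 𝒳 h h′ → v ≤ᶠ h′
  Step-preserves-Stable-≤ᶠ (¬I , _ , _) v≤h (ruleI A B x x∈𝒳 A∩B⊆x _ upd) =
    updatedAt-preserves-≤ᶠ upd v≤h
      (ℤ.≤-trans (ℤ.≮⇒≥ λ lt → ¬I (A , B , x , x∈𝒳 , A∩B⊆x , lt))
                 (ℤ.+-monoˡ-≤ (- bound 𝒳 A B x) (ℤ.+-mono-≤ (v≤h A) (v≤h B))))
  Step-preserves-Stable-≤ᶠ (_ , ¬II , _) v≤h (ruleII _ A B A⊂B _ upd) =
    updatedAt-preserves-≤ᶠ upd v≤h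
      (ℤ.≤-trans (ℤ.≮⇒≥ λ lt → ¬II (A , B , A⊂B , lt)) (v≤h B))
  Step-preserves-Stable-≤ᶠ (_ , _ , ¬III) v≤h (ruleIII _ _ A B B⊂A _ upd) =
    updatedAt-preserves-≤ᶠ upd v≤h
      (ℤ.≤-trans (ℤ.≮⇒≥ λ lt → ¬III (A , B , B⊂A , lt)) (ℤ.+-monoˡ-≤ _ (v≤h B)))
  Step-preserves-Stable-≤ᶠ {v} _ v≤h (ruleIV _ _ _ h′≡h) F =
    subst (v F ≤_) (sym (h′≡h F)) (v≤h F)

  IsValX-≤ : ∀ {F a b} → IsValX 𝒳 F a → IsValX 𝒳 F b → a ≤ b
  IsValX-≤ {a = a} (_ , a-min) ((S , S-proper , valS≡b) , _) =
    subst (a ≤_) valS≡b (a-min S S-proper)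

  module _ {f : ℕ → SetFun d} (steps : ∀ n → Step 𝒳 (f n) (f (suc n))) where

    steps-≤ᶠ-start : ∀ n → f n ≤ᶠ f 0
    steps-≤ᶠ-start zero    = ≤ᶠ-refl
    steps-≤ᶠ-start (suc n) = ≤ᶠ-trans (Step-≤ᶠ (steps n)) (steps-≤ᶠ-start n)

    steps-preserve-Stable-≤ᶠ : ∀ {v} → Stable v → v ≤ᶠ f 0 → ∀ n → v ≤ᶠ f n
    steps-preserve-Stable-≤ᶠ _      v≤f₀ zero    = v≤f₀
    steps-preserve-Stable-≤ᶠ stable v≤f₀ (suc n) =
      Step-preserves-Stable-≤ᶠ stable (steps-preserve-Stable-≤ᶠ stable v≤f₀ n) (steps n)

    constantFrom⇒Stable : ∀ {N} → ConstantFrom 𝒳 f N → Stable (f N)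
    constantFrom⇒Stable {N} const = Step-unchanged⇒Stable (steps N) (const (suc N) (ℕ.n≤1+n N))

  eventualValue-≤ : ∀ {f g} → IsUpdateSeq 𝒳 f → IsUpdateSeq 𝒳 g
                  → ∀ {N} → ConstantFrom 𝒳 f N → ∀ M → f N ≤ᶠ g M
  eventualValue-≤ {f} {g} (f₀-val , f-steps) (g₀-val , g-steps) {N} f-const =
    steps-preserve-Stable-≤ᶠ g-steps (constantFrom⇒Stable f-steps f-const) fN≤g₀
    where
    fN≤g₀ : f N ≤ᶠ g 0
    fN≤g₀ F = ℤ.≤-trans (steps-≤ᶠ-start f-steps N F) (IsValX-≤ {F} (f₀-val F) (g₀-val F))

lemma6p7 : (d : ℕ) (𝒳 : Family d) → All Nonempty 𝒳
         → (f g : ℕ → SetFun d)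
         → IsUpdateSeq 𝒳 f → IsUpdateSeq 𝒳 g
         → (N M : ℕ) → ConstantFrom 𝒳 f N → ConstantFrom 𝒳 g M
         → ∀ F → f N F ≡ g M F
lemma6p7 d 𝒳 _ f g f-upd g-upd N M f-const g-const F =
  ℤ.≤-antisym (eventualValue-≤ 𝒳 f-upd g-upd f-const M F)
              (eventualValue-≤ 𝒳 g-upd f-upd g-const N F)
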